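{- Let $q\ge2$ and $n\ge1$ be integers. Under scenario $(**)$, the family $\mathcal{G}_q=\{x\mapsto[\![x\ge t]\!]\}_{t\in[q\rangle}$ is $n$-cell implementable if and only if $q\le 2n$ when $n\in\{1,2\}$, and $q\le 2n+1$ when $n\ge3$.
   Context: $[b\rangle=\{0,1,\ldots,b-1\}$. Let $\mathbb{B}=\{0,1\}$, $\mathbb{B}_\circ=\mathbb{B}$, $\mathbb{B}_*=\mathbb{B}\cup\{*\}$, $\mathbb{B}_\bullet=\mathbb{B}\cup\{*,\bullet\}$. Define $\mathrm{T}:\mathbb{B}_\bullet^2\to\mathbb{B}$ by $\mathrm{T}(u,\vartheta)=1$ if and only if $u=*$, or $\vartheta=*$, or $u=\vartheta\in\mathbb{B}$. $[\![\cdot]\!]$ is the Iverson bracket. $\mathcal{F}_q$ is the set of all functions $[q\rangle\to\mathbb{B}$. For $\alpha,\beta\in\{\circ,*,\bullet\}$, a subset $\Phi\subseteq\mathcal{F}_q$ is $n$-cell implementable under scenario $(\alpha\beta)$ if there exist mappings $\mathbf{u}=(u_j)_{j\in[n\rangle}:[q\rangle\to\mathbb{B}_\alpha^n$ and $\boldsymbol{\vartheta}=(\vartheta_j)_{j\in[n\rangle}:\Phi\to\mathbb{B}_\beta^n$ such that $f(x)=\bigwedge_{j\in[n\rangle}\mathrm{T}(u_j(x),\vartheta_j(f))$ for all $f\in\Phi$ and $x\in[q\rangle$. -}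

module Defs where

open import Data.Nat using (ℕ; zero; suc; _≤_; _<_; _≤ᵇ_; _*_; _+_)
open import Data.Bool using (Bool; true; false; _∧_)
open import Data.Fin using (Fin; toℕ)
import Data.Fin as F
open import Data.Product using (Σ; _×_)
open import Relation.Binary.PropositionalEquality using (_≡_)

data B* : Set where
  b0 b1 star : B*

T : B* → B* → Bool
T star _    = true
T _    star = true
T b0   b0   = true
T b1   b1   = true
T b0   b1   = false
T b1   b0   = false

⋀ : (n : ℕ) → (Fin n → Bool) → Bool
⋀ zero    a = true
⋀ (suc n) a = a F.zero ∧ ⋀ n (λ j → a (F.suc j))

thr : {q : ℕ} → Fin q → Fin q → Bool
thr t x = toℕ t ≤ᵇ toℕ x

-- G_q is n-cell implementable under scenario (**): there exist
-- u : [q⟩ → B_*^n and θ : G_q → B_*^n with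
-- g_t(x) = ⋀_j T(u_j(x), θ_j(g_t)) for all t, x.
-- (G_q is indexed by t; the map t ↦ g_t is injective, so this is the same as
-- a map on the set of functions.)
Implementable** : (q n : ℕ) → Set
Implementable** q n =
  Σ (Fin q → Fin n → B*) λ u →
  Σ (Fin q → Fin n → B*) λ θ →
  ∀ (t x : Fin q) → thr t x ≡ ⋀ n (λ j → T (u x j) (θ t j))

bound : ℕ → ℕ
bound 1 = 2
bound 2 = 4
bound n = 2 * n + 1

-- The set where cell j outputs 0 is the union of two "rectangles"
-- {x : u_j(x) = β} × {t : θ_j(t) = ¬β}, β ∈ {0,1}, whose sides are disjoint, and
-- every rectangle lies strictly below the diagonal x < t. The pairs (i, i+1) each
-- need a rectangle and no rectangle holds two of them, so q - 1 ≤ 2n. When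
-- q - 1 = 2n every rectangle is the key of exactly one i, and the two rectangles of
-- a cell pair up the keys. For n ≤ 2 every such pairing leaves some pair x < t
-- uncovered: partners i, i+1 leave (i, i+2), and the crossing pairing {0,2}, {1,3}
-- leaves (0,4). Conversely, explicit tables realise 2 points with 1 cell and 7 points
-- with 3 cells, and each extra cell accommodates two extra points.
module Submission where

open import Defs
open import Data.Nat using (ℕ; _≤_)
open import Function.Bundles using (_⇔_)

open import Data.Nat using (zero; suc; _<_; _≤ᵇ_; _<ᵇ_; _*_; _+_; s≤s; z≤n)
open import Data.Nat.Properties
  using ( _≤?_; ≤-refl; ≤-reflexive; ≤-trans; ≤-antisym; ≤-pred; <-irrefl; <⇒≤; <⇒≱; ≰⇒>; ≤∧≢⇒<
        ; n≤1+n; n<1+n; m≤n⇒m<n∨m≡n; m<1+n⇒m<n∨m≡n; ≤⇒≤ᵇ; ≤ᵇ⇒≤; <⇒<ᵇ; *-comm; *-suc; +-comm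
        ; allUpTo? )
open import Data.Bool using (Bool; true; false; not; if_then_else_)
import Data.Bool as Bool
open import Data.Bool.Properties using (T-≡; ¬-not; not-¬; not-involutive)
open import Data.Fin using (Fin; toℕ; inject₁)
import Data.Fin as Fin
open import Data.Fin.Patterns using (0F; 1F; 2F; 3F; 4F)
open import Data.Fin.Properties using (toℕ<n; toℕ-inject₁; toℕ-injective; injective⇒≤; any?; *↔×; 2↔Bool)
open import Data.Product using (∃; ∃₂; _×_; _,_; proj₁; proj₂)
open import Data.Product.Properties using (≡-dec)
open import Data.Product.Function.NonDependent.Propositional using (_×-↔_)
open import Data.Sum using (_⊎_; inj₁; inj₂)
open import Data.Vec.Functional using (_∷_)
open import Data.Empty using (⊥; ⊥-elim)
open import Function using (_∘_; case_of_)
open import Function.Bundles using (mk⇔; _↔_; _↣_; Injection; Equivalence)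
open import Function.Definitions using (Injective)
open import Function.Construct.Identity using (↔-id)
open import Function.Properties.Inverse using (↔-sym; ↔-trans; ↔⇒↣)
open import Relation.Nullary using (¬_; Dec; from-yes; yes; no; contradiction)
open import Relation.Binary.Definitions using (DecidableEquality)
open import Relation.Binary.PropositionalEquality using (_≡_; _≢_; refl; sym; trans; cong; subst; subst₂)

private
  variable
    k m n : ℕ

≤ᵇ-true : ∀ {m n} → m ≤ n → (m ≤ᵇ n) ≡ true
≤ᵇ-true = Equivalence.to T-≡ ∘ ≤⇒≤ᵇ

≤ᵇ-false : ∀ {m n} → n < m → (m ≤ᵇ n) ≡ false
≤ᵇ-false {m} {n} n<m = ¬-not λ m≤ᵇn → <⇒≱ n<m (≤ᵇ⇒≤ m n (Equivalence.from T-≡ m≤ᵇn))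

⋀-true⁺ : ∀ n {a : Fin n → Bool} → (∀ j → a j ≡ true) → ⋀ n a ≡ true
⋀-true⁺ zero    _   = refl
⋀-true⁺ (suc n) all rewrite all 0F = ⋀-true⁺ n (all ∘ Fin.suc)

⋀-true⁻ : ∀ n {a : Fin n → Bool} → ⋀ n a ≡ true → ∀ j → a j ≡ true
⋀-true⁻ (suc n) {a} ⋀a with a 0F in a₀
⋀-true⁻ (suc n) ⋀a | true = λ { 0F → a₀ ; (Fin.suc j) → ⋀-true⁻ n ⋀a j }

⋀-false⁻ : ∀ n {a : Fin n → Bool} → ⋀ n a ≡ false → ∃ λ j → a j ≡ false
⋀-false⁻ (suc n) {a} ⋀a with a 0F in a₀
... | false = 0F , a₀
... | true  with j , aⱼ ← ⋀-false⁻ n ⋀a = Fin.suc j , aⱼ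

between-adjacent : ∀ {a k b} → a ≤ k → k ≤ b → b ≡ suc a → k ≡ a ⊎ k ≡ b
between-adjacent a≤k k≤b refl with m≤n⇒m<n∨m≡n k≤b
... | inj₁ k<1+a = inj₁ (≤-antisym (≤-pred k<1+a) a≤k)
... | inj₂ k≡1+a = inj₂ k≡1+a

lit : Bool → B*
lit false = b0
lit true  = b1

lit-not-distinct : ∀ β → lit β ≢ lit (not β)
lit-not-distinct false ()
lit-not-distinct true  ()

T-lit-not : ∀ β → T (lit β) (lit (not β)) ≡ false
T-lit-not false = refl
T-lit-not true  = refl

T≡false⇒lit-not : ∀ a c → T a c ≡ false → ∃ λ β → a ≡ lit β × c ≡ lit (not β)
T≡false⇒lit-not b0 b1 _ = false , refl , refl
T≡false⇒lit-not b1 b0 _ = true , refl , refl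
T≡false⇒lit-not b0 b0 ()
T≡false⇒lit-not b1 b1 ()
T≡false⇒lit-not b0 star ()
T≡false⇒lit-not b1 star ()
T≡false⇒lit-not star _ ()

injective⇒surjective : {A : Set} → A ↣ Fin k → DecidableEquality A → k ≤ m →
                       {f : Fin m → A} → Injective _≡_ _≡_ f → ∀ a → ∃ λ i → f i ≡ a
injective⇒surjective A↣ _≟_ k≤m {f} f-inj a with any? (λ i → f i ≟ a)
... | yes hit  = hit
... | no  miss =
  contradiction (≤-trans (injective⇒≤ {f = A↣.to ∘ (a ∷ f)} (a∷f-inj ∘ A↣.injective)) k≤m) (<-irrefl refl)
  where
  module A↣ = Injection A↣
  a∷f-inj : Injective _≡_ _≡_ (a ∷ f)
  a∷f-inj {0F}        {0F}        _  = refl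
  a∷f-inj {0F}        {Fin.suc j} eq = contradiction (j , sym eq) miss
  a∷f-inj {Fin.suc i} {0F}        eq = contradiction (i , eq) miss
  a∷f-inj {Fin.suc i} {Fin.suc j} eq = cong Fin.suc (f-inj eq)

-- (j , β) is the rectangle of cell j with sides {x | u x j = β} and {t | θ t j = ¬ β}.
Rect : ℕ → Set
Rect n = Fin n × Bool

opp : Rect n → Rect n
opp (j , β) = j , not β

opp-involutive : (r : Rect n) → opp (opp r) ≡ r
opp-involutive (j , β) = cong (j ,_) (not-involutive β)

opp-not-fixed : (r : Rect n) → r ≢ opp r
opp-not-fixed (j , β) = not-¬ refl ∘ cong proj₂

Rect↔Fin : Rect n ↔ Fin (n * 2)
Rect↔Fin = ↔-trans (↔-id _ ×-↔ ↔-sym 2↔Bool) (↔-sym *↔×)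

module Rectangles {q' n} (u θ : Fin (suc q') → Fin n → B*)
                  (impl : ∀ t x → thr t x ≡ ⋀ n (λ j → T (u x j) (θ t j))) where

  _∈ᵘ_ : Fin (suc q') → Rect n → Set
  x ∈ᵘ (j , β) = u x j ≡ lit β

  _∈ᶿ_ : Fin (suc q') → Rect n → Set
  t ∈ᶿ (j , β) = θ t j ≡ lit (not β)

  ∈ᵘ-opp : ∀ {x} r → x ∈ᵘ r → x ∈ᵘ opp r → ⊥
  ∈ᵘ-opp (j , β) x∈r x∈r̄ = lit-not-distinct β (trans (sym x∈r) x∈r̄)

  ∈ᶿ-opp : ∀ {t} r → t ∈ᶿ r → t ∈ᶿ opp r → ⊥
  ∈ᶿ-opp (j , β) t∈r t∈r̄ = lit-not-distinct (not β) (trans (sym t∈r) t∈r̄)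

  below-diagonal : ∀ {x t r} → x ∈ᵘ r → t ∈ᶿ r → toℕ x < toℕ t
  below-diagonal {x} {t} {j , β} x∈r t∈r with toℕ t ≤? toℕ x
  ... | no  t≰x = ≰⇒> t≰x
  ... | yes t≤x = contradiction (⋀-true⁻ n (trans (sym (impl t x)) (≤ᵇ-true t≤x)) j) Tⱼ≢true
    where
    Tⱼ≢true : T (u x j) (θ t j) ≢ true
    Tⱼ≢true rewrite x∈r | t∈r | T-lit-not β = λ ()

  covered : ∀ {x t} → toℕ x < toℕ t → ∃ λ r → x ∈ᵘ r × t ∈ᶿ r
  covered {x} {t} x<t with j , Tⱼ ← ⋀-false⁻ n (trans (sym (impl t x)) (≤ᵇ-false x<t))
                      with β , uxj , θtj ← T≡false⇒lit-not _ _ Tⱼ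
                      = (j , β) , uxj , θtj

  key-covers : (i : Fin q') → ∃ λ r → inject₁ i ∈ᵘ r × Fin.suc i ∈ᶿ r
  key-covers i = covered (s≤s (≤-reflexive (toℕ-inject₁ i)))

  key : Fin q' → Rect n
  key = proj₁ ∘ key-covers

  key-∈ᵘ : ∀ i → inject₁ i ∈ᵘ key i
  key-∈ᵘ = proj₁ ∘ proj₂ ∘ key-covers

  key-∈ᶿ : ∀ i → Fin.suc i ∈ᶿ key i
  key-∈ᶿ = proj₂ ∘ proj₂ ∘ key-covers

  key-range : ∀ {x t m} → x ∈ᵘ key m → t ∈ᶿ key m → toℕ x ≤ toℕ m × toℕ m < toℕ t
  key-range {m = m} x∈ t∈ =
    ≤-pred (below-diagonal x∈ (key-∈ᶿ m)) ,
    subst (_< _) (toℕ-inject₁ m) (below-diagonal (key-∈ᵘ m) t∈)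

  key-injective : Injective _≡_ _≡_ key
  key-injective {i} {k} keyᵢ≡keyₖ = toℕ-injective (≤-antisym
    (key-order (subst (_ ∈ᵘ_) keyᵢ≡keyₖ (key-∈ᵘ i)))
    (key-order (subst (_ ∈ᵘ_) (sym keyᵢ≡keyₖ) (key-∈ᵘ k))))
    where
    key-order : ∀ {i m} → inject₁ i ∈ᵘ key m → toℕ i ≤ toℕ m
    key-order {i} i∈ = subst (_≤ _) (toℕ-inject₁ i) (proj₁ (key-range i∈ (key-∈ᶿ _)))

  keys-fit : q' ≤ n * 2
  keys-fit = injective⇒≤ (key-injective ∘ Injection.injective (↔⇒↣ Rect↔Fin))

  Partners : Fin q' → Fin q' → Set
  Partners i m = key m ≡ opp (key i)

  partners-sym : ∀ {i m} → Partners i m → Partners m i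
  partners-sym {i} p = sym (trans (cong opp p) (opp-involutive (key i)))

  partners-irrefl : ∀ {i} → ¬ Partners i i
  partners-irrefl {i} = opp-not-fixed (key i)

  partners-functional : ∀ {i m m'} → Partners i m → Partners i m' → m ≡ m'
  partners-functional p p' = key-injective (trans p (sym p'))

  partners-disjointᵘ : ∀ {i m x} → Partners i m → x ∈ᵘ key i → x ∈ᵘ key m → ⊥
  partners-disjointᵘ {i} p x∈ᵢ x∈ₘ = ∈ᵘ-opp (key i) x∈ᵢ (subst (_ ∈ᵘ_) p x∈ₘ)

  partners-disjointᶿ : ∀ {i m t} → Partners i m → t ∈ᶿ key i → t ∈ᶿ key m → ⊥
  partners-disjointᶿ {i} p t∈ᵢ t∈ₘ = ∈ᶿ-opp (key i) t∈ᵢ (subst (_ ∈ᶿ_) p t∈ₘ)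

  module Tight (tight : n * 2 ≤ q') where

    keys-onto : ∀ r → ∃ λ m → key m ≡ r
    keys-onto = injective⇒surjective (↔⇒↣ Rect↔Fin) (≡-dec Fin._≟_ Bool._≟_) tight key-injective

    locate : ∀ {x t} → toℕ x < toℕ t → ∃ λ m → x ∈ᵘ key m × t ∈ᶿ key m
    locate x<t with r , x∈ , t∈ ← covered x<t with m , refl ← keys-onto r = m , x∈ , t∈

    partner : ∀ i → ∃ (Partners i)
    partner i = keys-onto (opp (key i))

    partners-not-adjacent : ∀ {i m} → toℕ m ≡ suc (toℕ i) → ¬ Partners i m
    partners-not-adjacent {i} {m} m≡1+i p
      with k , x∈ , t∈ ← locate {inject₁ i} {Fin.suc m}
                               (s≤s (subst₂ _≤_ (sym (toℕ-inject₁ i)) (sym m≡1+i) (n≤1+n _)))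
      with i≤k , s≤s k≤m ← key-range x∈ t∈
      with between-adjacent (subst (_≤ _) (toℕ-inject₁ i) i≤k) k≤m m≡1+i
    ... | inj₁ k≡i with refl ← toℕ-injective k≡i = partners-disjointᶿ p t∈ (key-∈ᶿ m)
    ... | inj₂ k≡m with refl ← toℕ-injective k≡m = partners-disjointᵘ p (key-∈ᵘ i) x∈

¬implementable-3-1 : ¬ Implementable** 3 1
¬implementable-3-1 (u , θ , impl) = no-partner (partner 0F)
  where
  open Rectangles u θ impl
  open Tight ≤-refl
  no-partner : ¬ ∃ (Partners 0F)
  no-partner (0F , p) = partners-irrefl p
  no-partner (1F , p) = partners-not-adjacent refl p

¬implementable-5-2 : ¬ Implementable** 5 2
¬implementable-5-2 (u , θ , impl) = no-partners (partner 0F , partner 1F)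
  where
  open Rectangles u θ impl
  open Tight ≤-refl

  crossing : Partners 0F 2F → Partners 1F 3F → ⊥
  crossing p₀₂ p₁₃ = corner (locate {0F} {4F} (s≤s z≤n))
    where
    0∈key₁ : 0F ∈ᵘ key 1F
    0∈key₁ with locate {0F} {3F} (s≤s z≤n)
    ... | 0F , _  , 3∈ = ⊥-elim (partners-disjointᶿ p₀₂ 3∈ (key-∈ᶿ 2F))
    ... | 1F , 0∈ , _  = 0∈
    ... | 2F , 0∈ , _  = ⊥-elim (partners-disjointᵘ p₀₂ (key-∈ᵘ 0F) 0∈)
    -- On numerals a false comparison m < n makes <⇒<ᵇ produce an element of ⊥.
    ... | 3F , _  , 3∈ = ⊥-elim (<⇒<ᵇ (below-diagonal (key-∈ᵘ 3F) 3∈))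

    4∈key₂ : 4F ∈ᶿ key 2F
    4∈key₂ with locate {1F} {4F} (s≤s (s≤s z≤n))
    ... | 0F , 1∈ , _  = ⊥-elim (<⇒<ᵇ (below-diagonal 1∈ (key-∈ᶿ 0F)))
    ... | 1F , _  , 4∈ = ⊥-elim (partners-disjointᶿ p₁₃ 4∈ (key-∈ᶿ 3F))
    ... | 2F , _  , 4∈ = 4∈
    ... | 3F , 1∈ , _  = ⊥-elim (partners-disjointᵘ p₁₃ (key-∈ᵘ 1F) 1∈)

    corner : ¬ ∃ λ m → 0F ∈ᵘ key m × 4F ∈ᶿ key m
    corner (0F , _  , 4∈) = partners-disjointᶿ p₀₂ 4∈ 4∈key₂
    corner (1F , _  , 4∈) = partners-disjointᶿ p₁₃ 4∈ (key-∈ᶿ 3F)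
    corner (2F , 0∈ , _ ) = partners-disjointᵘ p₀₂ (key-∈ᵘ 0F) 0∈
    corner (3F , 0∈ , _ ) = partners-disjointᵘ p₁₃ 0∈key₁ 0∈

  no-partners : ¬ (∃ (Partners 0F) × ∃ (Partners 1F))
  no-partners ((0F , p) , _) = partners-irrefl p
  no-partners ((1F , p) , _) = partners-not-adjacent refl p
  no-partners (_ , (1F , p)) = partners-irrefl p
  no-partners (_ , (2F , p)) = partners-not-adjacent refl p
  no-partners ((2F , p) , (0F , p')) = case partners-functional p (partners-sym p') of λ ()
  no-partners ((2F , p) , (3F , p')) = crossing p p'
  no-partners ((3F , p) , (0F , p')) = case partners-functional p (partners-sym p') of λ ()
  no-partners ((3F , p) , (3F , p')) =
    case partners-functional (partners-sym p) (partners-sym p') of λ ()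

implementable⇒≤2n+1 : ∀ {q n} → Implementable** q n → q ≤ 2 * n + 1
implementable⇒≤2n+1 {zero}   _              = z≤n
implementable⇒≤2n+1 {suc q'} {n} (u , θ , impl) =
  subst (suc q' ≤_) (trans (cong suc (*-comm n 2)) (+-comm 1 (2 * n)))
    (s≤s (Rectangles.keys-fit u θ impl))

implementable⇒≤bound : ∀ q n → Implementable** q n → q ≤ bound n
implementable⇒≤bound q 0 I = implementable⇒≤2n+1 I
implementable⇒≤bound q 1 I = ≤-pred (≤∧≢⇒< (implementable⇒≤2n+1 I) λ { refl → ¬implementable-3-1 I })
implementable⇒≤bound q 2 I = ≤-pred (≤∧≢⇒< (implementable⇒≤2n+1 I) λ { refl → ¬implementable-5-2 I })
implementable⇒≤bound q (suc (suc (suc _))) I = implementable⇒≤2n+1 I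

-- Points, thresholds and cells indexed by ℕ; values outside the ranges are irrelevant.
Realises : (q n : ℕ) (u θ : ℕ → ℕ → B*) → Set
Realises q n u θ =
  ∀ {t} → t < q → ∀ {x} → x < q → (t ≤ᵇ x) ≡ ⋀ n (λ j → T (u x (toℕ j)) (θ t (toℕ j)))

realises? : ∀ q n u θ → Dec (Realises q n u θ)
realises? q n u θ = allUpTo? (λ t → allUpTo? (λ x →
  (t ≤ᵇ x) Bool.≟ ⋀ n (λ j → T (u x (toℕ j)) (θ t (toℕ j)))) q) q

data Position (q : ℕ) : ℕ → Set where
  first : Position q zero
  inner : ∀ {t} → t < q → Position q (suc t)
  last  : Position q (suc q)

position : ∀ {q t} → t < 2 + q → Position q t
position {t = zero}  _ = first
position {t = suc t} (s≤s t<1+q) with m<1+n⇒m<n∨m≡n t<1+q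
... | inj₁ t<q  = inner t<q
... | inj₂ refl = last

≤ᵇ-suc : ∀ t x → (suc t ≤ᵇ suc x) ≡ (t ≤ᵇ x)
≤ᵇ-suc zero    x = refl
≤ᵇ-suc (suc t) x = refl

T-starʳ : ∀ a → T a star ≡ true
T-starʳ b0   = refl
T-starʳ b1   = refl
T-starʳ star = refl

-- One more cell buys two more points: a new point 0 rejected by all thresholds
-- t ≥ 1, and a new last point accepted by all of them.
module Widen {q n : ℕ} (u θ : ℕ → ℕ → B*) where

  u⁺ : ℕ → ℕ → B*
  u⁺ zero    _       = b0
  u⁺ (suc x) zero    = if x <ᵇ q then b1 else star
  u⁺ (suc x) (suc j) = if x <ᵇ q then u x j else star

  θ⁺ : ℕ → ℕ → B*
  θ⁺ zero    _       = star
  θ⁺ (suc t) zero    = if t <ᵇ q then b1 else b0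
  θ⁺ (suc t) (suc j) = if t <ᵇ q then θ t j else b1

  widen : Realises q (suc n) u θ → Realises (2 + q) (2 + n) u⁺ θ⁺
  widen r {t} t< {x} x< with position {q} t< | position {q} x<
  ... | first     | _         = sym (⋀-true⁺ (2 + n) (λ j → T-starʳ (u⁺ x (toℕ j))))
  ... | inner t<q | first     rewrite ≤ᵇ-true t<q = refl
  ... | last      | first     rewrite ≤ᵇ-false (n<1+n q) = refl
  ... | inner {t₀} t<q | inner {x₀} x<q rewrite ≤ᵇ-true t<q | ≤ᵇ-true x<q =
    trans (≤ᵇ-suc t₀ x₀) (r t<q x<q)
  ... | last      | inner x<q rewrite ≤ᵇ-false (n<1+n q) | ≤ᵇ-true x<q = ≤ᵇ-false (s≤s x<q)
  ... | inner t<q | last      rewrite ≤ᵇ-false (n<1+n q) =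
    trans (≤ᵇ-true (s≤s (<⇒≤ t<q))) (sym (⋀-true⁺ (2 + n) λ _ → refl))
  ... | last      | last      rewrite ≤ᵇ-false (n<1+n q) =
    trans (≤ᵇ-true (≤-refl {suc q})) (sym (⋀-true⁺ (2 + n) λ _ → refl))

Realisable : ℕ → ℕ → Set
Realisable q n = ∃₂ λ u θ → Realises q n u θ

widen-realisable : ∀ {q n} → Realisable q (suc n) → Realisable (2 + q) (2 + n)
widen-realisable {q} {n} (u , θ , r) = u⁺ , θ⁺ , widen r
  where open Widen {q} {n} u θ

realisable⇒implementable : ∀ {q n} → Realisable q n → Implementable** q n
realisable⇒implementable (u , θ , r) =
  (λ x j → u (toℕ x) (toℕ j)) , (λ t j → θ (toℕ t) (toℕ j)) , λ t x → r (toℕ<n t) (toℕ<n x)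

realisable-mono : ∀ {q q' n} → q ≤ q' → Realisable q' n → Realisable q n
realisable-mono q≤q' (u , θ , r) = u , θ , λ t<q x<q → r (≤-trans t<q q≤q') (≤-trans x<q q≤q')

realisable-2-1 : Realisable 2 1
realisable-2-1 = u , θ , from-yes (realises? 2 1 u θ)
  where
  u θ : ℕ → ℕ → B*
  u 0 _ = b0
  u _ _ = star
  θ 1 _ = b1
  θ _ _ = star

realisable-7-3 : Realisable 7 3
realisable-7-3 = u , θ , from-yes (realises? 7 3 u θ)
  where
  u θ : ℕ → ℕ → B*
  u 0 0 = b0 ; u 0 1 = b0 ; u 0 2 = b0
  u 1 0 = b1 ; u 1 1 = b0 ; u 1 2 = b1
  u 2 0 = b1 ; u 2 1 = b1
  u 3 1 = b1 ; u 3 2 = b0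
  u 4 1 = b1
  u 5 2 = b1
  u _ _ = star
  θ 1 0 = b1
  θ 2 0 = b1 ; θ 2 1 = b1
  θ 3 0 = b0 ; θ 3 1 = b1
  θ 4 0 = b0 ; θ 4 1 = b1 ; θ 4 2 = b1
  θ 5 0 = b0 ; θ 5 1 = b0 ; θ 5 2 = b1
  θ 6 0 = b1 ; θ 6 1 = b0 ; θ 6 2 = b0
  θ _ _ = star

bound-realisable : ∀ n → Realisable (bound n) n
bound-realisable 0 = all-star , all-star , from-yes (realises? 1 0 all-star all-star)
  where
  all-star : ℕ → ℕ → B*
  all-star _ _ = star
bound-realisable 1 = realisable-2-1
bound-realisable 2 = widen-realisable {2} {0} realisable-2-1
bound-realisable 3 = realisable-7-3
bound-realisable (suc n@(suc (suc (suc k)))) =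
  subst (λ q → Realisable q (suc n)) (sym (cong (_+ 1) (*-suc 2 n)))
    (widen-realisable {bound n} {2 + k} (bound-realisable n))

implementable⇔≤bound : ∀ q n → Implementable** q n ⇔ (q ≤ bound n)
implementable⇔≤bound q n = mk⇔ (implementable⇒≤bound q n) λ q≤bound →
  realisable⇒implementable (realisable-mono {n = n} q≤bound (bound-realisable n))

proposition9 : (q n : ℕ) → 2 ≤ q → 1 ≤ n →
    Implementable** q n ⇔ (q ≤ bound n)
proposition9 q n _ _ = implementable⇔≤bound q n
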